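{- Let $k>1$ be an integer. Then for every positive integer $n$, $$\sum_{a=0}^{n-1}\ \sum_{j=0}^{k-1}\ \sum_{\substack{ -a\le i_1<\cdots<i_j\le-1\\ 1\le i'_1<\cdots<i'_{k-1-j}\le n-1-a}}\frac{1}{i_1\cdots i_j\cdot i'_1\cdots i'_{k-1-j}}=0.$$
   Context: All indices are integers; the inner sum is over strictly increasing $j$-tuples in $[-a,-1]$ and strictly increasing $(k-1-j)$-tuples in $[1,n-1-a]$; an empty product equals $1$ and an empty sum equals $0$. -}

module Defs where

open import Data.Nat as ℕ using (ℕ; zero; suc)
open import Data.Integer as ℤ using (ℤ; +_; -[1+_])
open import Data.Rational as ℚ using (ℚ; 0ℚ; _/_)
open import Data.List using (List; []; _∷_; map; foldr; applyUpTo; _++_)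

-- reciprocal of a nonzero integer as a rational (value at 0 is irrelevant:
-- it is never used, as all entries of the tuples below are nonzero)
recipℤ : ℤ → ℚ
recipℤ (+ zero)    = 0ℚ
recipℤ (+ suc d)   = + 1 / suc d
recipℤ -[1+ d ]    = -[1+ 0 ] / suc d

productℤ : List ℤ → ℤ
productℤ = foldr ℤ._*_ (+ 1)

sumℚ : List ℚ → ℚ
sumℚ = foldr ℚ._+_ 0ℚ

Σ< : ℕ → (ℕ → ℚ) → ℚ
Σ< n f = sumℚ (applyUpTo f n)

interval : ℤ → ℕ → List ℤ
interval lo len = applyUpTo (λ t → lo ℤ.+ + t) len

-- all sublists of size j (order preserved): for an increasing list these are
-- exactly the strictly increasing j-tuples of its elements
choose : {A : Set} → ℕ → List A → List (List A)
choose zero    xs       = [] ∷ []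
choose (suc j) []       = []
choose (suc j) (x ∷ xs) = map (x ∷_) (choose j xs) ++ choose (suc j) xs

negTuples : ℕ → ℕ → List (List ℤ)
negTuples a j = choose j (interval (ℤ.- (+ a)) a)

posTuples : ℕ → ℕ → List (List ℤ)
posTuples N m = choose m (interval (+ 1) N)

innerSum : ℕ → ℕ → ℕ → ℕ → ℚ
innerSum n k a j =
  sumℚ (Data.List.concatMap
          (λ I → map (λ I' → recipℤ (productℤ I ℤ.* productℤ I'))
                     (posTuples (n ℕ.∸ 1 ℕ.∸ a) (k ℕ.∸ 1 ℕ.∸ j)))
          (negTuples a j))

-- The sums over increasing tuples are elementary symmetric functions of the
-- reciprocals, so the inner sum over j is the coefficient of t^(k-1) in
--   F a m = ∏_{i=1}^{a} (1 - t/i) · ∏_{i=1}^{m} (1 + t/i),   m = n - 1 - a.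
-- Since (a+1) F (a+1) m = (a+1-t) F a m and (m+1) F a (m+1) = (m+1+t) F a m,
-- the antidiagonal sums S_N = Σ_{a+m=N} F a m satisfy (N+1) S_{N+1} = (N+2) S_N.
-- Hence S_N = N + 1 is constant in t, and its coefficient of t^(k-1), k > 1, vanishes.

{-# OPTIONS --safe #-}
module Submission where

open import Defs
open import Data.Nat using (ℕ; _<_)
open import Data.Rational using (0ℚ)
open import Relation.Binary.PropositionalEquality using (_≡_)

open import Data.Nat as ℕ using (zero; suc; _∸_; _≤_; s≤s)
import Data.Nat.Properties as ℕP
open import Data.Integer as ℤ using (ℤ; +_; -[1+_])
import Data.Integer.Properties as ℤP
open import Data.Rational using (ℚ; 1ℚ; _+_; _*_; -_; _/_; fromℚᵘ)
import Data.Rational.Properties as ℚP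
open import Data.Rational.Solver using (module +-*-Solver)
open import Data.Rational.Unnormalised as ℚᵘ using (ℚᵘ; mkℚᵘ; 0ℚᵘ; _≃_; *≡*)
import Data.Rational.Unnormalised.Properties as ℚᵘP
open import Data.List using (List; []; _∷_; _∷ʳ_; _++_; map; applyUpTo; concatMap)
import Data.List.Properties as LP
open import Function using (_∘_)
open import Relation.Binary.PropositionalEquality
  using (refl; sym; trans; cong; cong₂; module ≡-Reasoning)

open +-*-Solver using (solve; _:=_; _:+_; _:*_; con)
open ≡-Reasoning

recipᵘ : ℤ → ℚᵘ
recipᵘ (+ zero)  = 0ℚᵘ
recipᵘ (+ suc d) = mkℚᵘ (+ 1) d
recipᵘ -[1+ d ]  = mkℚᵘ -[1+ 0 ] d

recipℤ≡fromℚᵘ-recipᵘ : ∀ z → recipℤ z ≡ fromℚᵘ (recipᵘ z)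
recipℤ≡fromℚᵘ-recipᵘ (+ zero)  = refl
recipℤ≡fromℚᵘ-recipᵘ (+ suc d) = refl
recipℤ≡fromℚᵘ-recipᵘ -[1+ d ]  = refl

-- In ℚᵘ no gcd normalisation is involved, so each sign case holds by computation.
recipᵘ-* : ∀ x y → recipᵘ (x ℤ.* y) ≃ recipᵘ x ℚᵘ.* recipᵘ y
recipᵘ-* (+ zero)  (+ zero)  = *≡* refl
recipᵘ-* (+ zero)  (+ suc n) = *≡* refl
recipᵘ-* (+ zero)  -[1+ n ]  = *≡* refl
recipᵘ-* (+ suc m) (+ zero)  rewrite ℤP.*-zeroʳ (+ suc m) = *≡* refl
recipᵘ-* (+ suc m) (+ suc n) = *≡* refl
recipᵘ-* (+ suc m) -[1+ n ]  = *≡* refl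
recipᵘ-* -[1+ m ]  (+ zero)  rewrite ℤP.*-zeroʳ -[1+ m ] = *≡* refl
recipᵘ-* -[1+ m ]  (+ suc n) = *≡* refl
recipᵘ-* -[1+ m ]  -[1+ n ]  = *≡* refl

fromℚᵘ-homo-+ : ∀ p q → fromℚᵘ (p ℚᵘ.+ q) ≡ fromℚᵘ p + fromℚᵘ q
fromℚᵘ-homo-+ p q = ℚP.toℚᵘ-injective (ℚᵘP.≃-trans (ℚP.toℚᵘ-fromℚᵘ (p ℚᵘ.+ q))
  (ℚᵘP.≃-sym (ℚᵘP.≃-trans (ℚP.toℚᵘ-homo-+ (fromℚᵘ p) (fromℚᵘ q))
                          (ℚᵘP.+-cong (ℚP.toℚᵘ-fromℚᵘ p) (ℚP.toℚᵘ-fromℚᵘ q)))))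

fromℚᵘ-homo-* : ∀ p q → fromℚᵘ (p ℚᵘ.* q) ≡ fromℚᵘ p * fromℚᵘ q
fromℚᵘ-homo-* p q = ℚP.toℚᵘ-injective (ℚᵘP.≃-trans (ℚP.toℚᵘ-fromℚᵘ (p ℚᵘ.* q))
  (ℚᵘP.≃-sym (ℚᵘP.≃-trans (ℚP.toℚᵘ-homo-* (fromℚᵘ p) (fromℚᵘ q))
                          (ℚᵘP.*-cong (ℚP.toℚᵘ-fromℚᵘ p) (ℚP.toℚᵘ-fromℚᵘ q)))))

-- This holds without side conditions because the junk value recipℤ 0 is 0.
recipℤ-* : ∀ x y → recipℤ (x ℤ.* y) ≡ recipℤ x * recipℤ y
recipℤ-* x y = begin
  recipℤ (x ℤ.* y)                       ≡⟨ recipℤ≡fromℚᵘ-recipᵘ (x ℤ.* y) ⟩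
  fromℚᵘ (recipᵘ (x ℤ.* y))              ≡⟨ ℚP.fromℚᵘ-cong (recipᵘ-* x y) ⟩
  fromℚᵘ (recipᵘ x ℚᵘ.* recipᵘ y)        ≡⟨ fromℚᵘ-homo-* (recipᵘ x) (recipᵘ y) ⟩
  fromℚᵘ (recipᵘ x) * fromℚᵘ (recipᵘ y)  ≡⟨ sym (cong₂ _*_ (recipℤ≡fromℚᵘ-recipᵘ x)
                                                          (recipℤ≡fromℚᵘ-recipᵘ y)) ⟩
  recipℤ x * recipℤ y                    ∎

recipℤ-neg : ∀ n → recipℤ -[1+ n ] ≡ - recipℤ (+ suc n)
recipℤ-neg n = refl

fromℕ : ℕ → ℚ
fromℕ n = + n / 1

fromℕ-+ : ∀ m n → fromℕ (m ℕ.+ n) ≡ fromℕ m + fromℕ n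
fromℕ-+ m n = begin
  fromℕ (m ℕ.+ n)                          ≡⟨ ℚP.fromℚᵘ-cong sumᵘ ⟩
  fromℚᵘ (mkℚᵘ (+ m) 0 ℚᵘ.+ mkℚᵘ (+ n) 0)  ≡⟨ fromℚᵘ-homo-+ (mkℚᵘ (+ m) 0) (mkℚᵘ (+ n) 0) ⟩
  fromℕ m + fromℕ n                        ∎
  where
  sumᵘ : mkℚᵘ (+ (m ℕ.+ n)) 0 ≃ mkℚᵘ (+ m) 0 ℚᵘ.+ mkℚᵘ (+ n) 0
  sumᵘ = *≡* (cong (ℤ._* + 1) (trans (ℤP.pos-+ m n)
           (sym (cong₂ ℤ._+_ (ℤP.*-identityʳ (+ m)) (ℤP.*-identityʳ (+ n))))))

fromℕ-*-recipℤ : ∀ n → fromℕ (suc n) * recipℤ (+ suc n) ≡ 1ℚ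
fromℕ-*-recipℤ n = trans (sym (fromℚᵘ-homo-* (mkℚᵘ (+ suc n) 0) (mkℚᵘ (+ 1) n)))
                         (ℚP.fromℚᵘ-cong (ℚᵘP.*-inverseʳ (mkℚᵘ (+ suc n) 0)))

fromℕ[1+n]*x≡0⇒x≡0 : ∀ n {x} → fromℕ (suc n) * x ≡ 0ℚ → x ≡ 0ℚ
fromℕ[1+n]*x≡0⇒x≡0 n {x} nx≡0 = begin
  x                        ≡⟨ sym (ℚP.*-identityˡ x) ⟩
  1ℚ * x                   ≡⟨ cong (_* x) (sym (fromℕ-*-recipℤ n)) ⟩
  (fromℕ (suc n) * r) * x  ≡⟨ cong (_* x) (ℚP.*-comm (fromℕ (suc n)) r) ⟩
  (r * fromℕ (suc n)) * x  ≡⟨ ℚP.*-assoc r (fromℕ (suc n)) x ⟩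
  r * (fromℕ (suc n) * x)  ≡⟨ cong (r *_) nx≡0 ⟩
  r * 0ℚ                   ≡⟨ ℚP.*-zeroʳ r ⟩
  0ℚ                       ∎
  where r = recipℤ (+ suc n)

sumℚ-++ : ∀ xs ys → sumℚ (xs ++ ys) ≡ sumℚ xs + sumℚ ys
sumℚ-++ []       ys = sym (ℚP.+-identityˡ (sumℚ ys))
sumℚ-++ (x ∷ xs) ys =
  trans (cong (_+_ x) (sumℚ-++ xs ys)) (sym (ℚP.+-assoc x (sumℚ xs) (sumℚ ys)))

sumℚ-map-*ˡ : ∀ {A : Set} c (f : A → ℚ) xs →
  sumℚ (map (λ a → c * f a) xs) ≡ c * sumℚ (map f xs)
sumℚ-map-*ˡ c f []       = sym (ℚP.*-zeroʳ c)
sumℚ-map-*ˡ c f (x ∷ xs) = trans (cong (_+_ (c * f x)) (sumℚ-map-*ˡ c f xs))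
                                 (sym (ℚP.*-distribˡ-+ c (f x) (sumℚ (map f xs))))

sumℚ-concatMap-separable : ∀ {A B : Set} (h : A → B → ℚ) (f : A → ℚ) (g : B → ℚ) →
  (∀ a b → h a b ≡ f a * g b) → ∀ xs ys →
  sumℚ (concatMap (λ a → map (h a) ys) xs) ≡ sumℚ (map f xs) * sumℚ (map g ys)
sumℚ-concatMap-separable h f g h≡fg []       ys = sym (ℚP.*-zeroˡ (sumℚ (map g ys)))
sumℚ-concatMap-separable h f g h≡fg (x ∷ xs) ys = begin
  sumℚ (map (h x) ys ++ concatMap (λ a → map (h a) ys) xs)
    ≡⟨ sumℚ-++ (map (h x) ys) _ ⟩
  sumℚ (map (h x) ys) + sumℚ (concatMap (λ a → map (h a) ys) xs)
    ≡⟨ cong₂ _+_ (trans (cong sumℚ (LP.map-cong (h≡fg x) ys)) (sumℚ-map-*ˡ (f x) g ys))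
                 (sumℚ-concatMap-separable h f g h≡fg xs ys) ⟩
  f x * sumℚ (map g ys) + sumℚ (map f xs) * sumℚ (map g ys)
    ≡⟨ sym (ℚP.*-distribʳ-+ (sumℚ (map g ys)) (f x) (sumℚ (map f xs))) ⟩
  (f x + sumℚ (map f xs)) * sumℚ (map g ys)
    ∎

applyUpTo-cong : ∀ {A : Set} n {f g : ℕ → A} → (∀ i → i < n → f i ≡ g i) →
  applyUpTo f n ≡ applyUpTo g n
applyUpTo-cong zero    f≡g = refl
applyUpTo-cong (suc n) f≡g =
  cong₂ _∷_ (f≡g 0 ℕ.z<s) (applyUpTo-cong n (λ i i<n → f≡g (suc i) (s≤s i<n)))

Σ<-cong : ∀ n {f g} → (∀ i → i < n → f i ≡ g i) → Σ< n f ≡ Σ< n g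
Σ<-cong n f≡g = cong sumℚ (applyUpTo-cong n f≡g)

Σ<-suc : ∀ n f → Σ< (suc n) f ≡ Σ< n f + f n
Σ<-suc n f = begin
  sumℚ (applyUpTo f (suc n))          ≡⟨ cong sumℚ (sym (LP.applyUpTo-∷ʳ f n)) ⟩
  sumℚ (applyUpTo f n ∷ʳ f n)         ≡⟨ sumℚ-++ (applyUpTo f n) (f n ∷ []) ⟩
  Σ< n f + (f n + 0ℚ)                 ≡⟨ cong (_+_ (Σ< n f)) (ℚP.+-identityʳ (f n)) ⟩
  Σ< n f + f n                        ∎

Σ<-+ : ∀ n f g → Σ< n (λ i → f i + g i) ≡ Σ< n f + Σ< n g
Σ<-+ zero    f g = refl
Σ<-+ (suc n) f g = begin
  (f 0 + g 0) + Σ< n (λ i → f (suc i) + g (suc i))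
    ≡⟨ cong (_+_ (f 0 + g 0)) (Σ<-+ n (f ∘ suc) (g ∘ suc)) ⟩
  (f 0 + g 0) + (Σ< n (f ∘ suc) + Σ< n (g ∘ suc))
    ≡⟨ solve 4 (λ a b c d → (a :+ b) :+ (c :+ d) := (a :+ c) :+ (b :+ d))
               refl (f 0) (g 0) (Σ< n (f ∘ suc)) (Σ< n (g ∘ suc)) ⟩
  (f 0 + Σ< n (f ∘ suc)) + (g 0 + Σ< n (g ∘ suc))
    ∎

Σ<-*ˡ : ∀ n c f → Σ< n (λ i → c * f i) ≡ c * Σ< n f
Σ<-*ˡ zero    c f = sym (ℚP.*-zeroʳ c)
Σ<-*ˡ (suc n) c f = trans (cong (_+_ (c * f 0)) (Σ<-*ˡ n c (f ∘ suc)))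
                          (sym (ℚP.*-distribˡ-+ c (f 0) (Σ< n (f ∘ suc))))

Σ<-+-shiftˡ : ∀ n u v → u 0 ≡ 0ℚ → v n ≡ 0ℚ →
  Σ< (suc n) (λ i → u i + v i) ≡ Σ< n (λ i → u (suc i) + v i)
Σ<-+-shiftˡ n u v u₀≡0 vₙ≡0 = begin
  Σ< (suc n) (λ i → u i + v i)
    ≡⟨ Σ<-+ (suc n) u v ⟩
  (u 0 + Σ< n (u ∘ suc)) + Σ< (suc n) v
    ≡⟨ cong₂ _+_ (cong (_+ Σ< n (u ∘ suc)) u₀≡0) (Σ<-suc n v) ⟩
  (0ℚ + Σ< n (u ∘ suc)) + (Σ< n v + v n)
    ≡⟨ cong₂ _+_ (ℚP.+-identityˡ (Σ< n (u ∘ suc)))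
                 (trans (cong (_+_ (Σ< n v)) vₙ≡0) (ℚP.+-identityʳ (Σ< n v))) ⟩
  Σ< n (u ∘ suc) + Σ< n v
    ≡⟨ sym (Σ<-+ n (u ∘ suc) v) ⟩
  Σ< n (λ i → u (suc i) + v i)
    ∎

-- Power series in t as coefficient sequences: shift is multiplication by t,
-- mulLinear x is multiplication by 1 + x t, and _⊛_ below is the product.
Series : Set
Series = ℕ → ℚ

shift : Series → Series
shift f zero    = 0ℚ
shift f (suc j) = f j

mulLinear : ℚ → Series → Series
mulLinear x f j = f j + x * shift f j

mulLinear-zero : ∀ x f → mulLinear x f 0 ≡ f 0
mulLinear-zero x f = trans (cong (_+_ (f 0)) (ℚP.*-zeroʳ x)) (ℚP.+-identityʳ (f 0))

mulLinear-cancel : ∀ c d x y f j → c * x + d * y ≡ 0ℚ →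
  c * mulLinear x f j + d * mulLinear y f j ≡ (c + d) * f j
mulLinear-cancel c d x y f j cx+dy≡0 = begin
  c * (f j + x * shift f j) + d * (f j + y * shift f j)
    ≡⟨ solve 6 (λ c d x y a s → c :* (a :+ x :* s) :+ d :* (a :+ y :* s)
                             := (c :+ d) :* a :+ (c :* x :+ d :* y) :* s)
               refl c d x y (f j) (shift f j) ⟩
  (c + d) * f j + (c * x + d * y) * shift f j
    ≡⟨ cong (λ z → (c + d) * f j + z * shift f j) cx+dy≡0 ⟩
  (c + d) * f j + 0ℚ * shift f j
    ≡⟨ solve 2 (λ a s → a :+ con 0ℚ :* s := a) refl ((c + d) * f j) (shift f j) ⟩
  (c + d) * f j
    ∎

esym : List ℚ → Series
esym xs       zero    = 1ℚ
esym []       (suc j) = 0ℚ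
esym (x ∷ xs) (suc j) = esym xs (suc j) + x * esym xs j

esym-∷ : ∀ x xs j → esym (x ∷ xs) j ≡ mulLinear x (esym xs) j
esym-∷ x xs zero    = sym (mulLinear-zero x (esym xs))
esym-∷ x xs (suc j) = refl

esym-∷ʳ : ∀ xs y j → esym (xs ∷ʳ y) j ≡ mulLinear y (esym xs) j
esym-∷ʳ xs       y zero    = sym (mulLinear-zero y (esym xs))
esym-∷ʳ []       y (suc j) = refl
esym-∷ʳ (x ∷ xs) y (suc j) = begin
  esym (xs ∷ʳ y) (suc j) + x * esym (xs ∷ʳ y) j
    ≡⟨ cong₂ (λ u v → u + x * v) (esym-∷ʳ xs y (suc j)) (esym-∷ʳ xs y j) ⟩
  (e (suc j) + y * e j) + x * (e j + y * shift e j)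
    ≡⟨ solve 5 (λ x y a b c → (a :+ y :* b) :+ x :* (b :+ y :* c)
                           := (a :+ x :* b) :+ y :* (b :+ x :* c))
               refl x y (e (suc j)) (e j) (shift e j) ⟩
  (e (suc j) + x * e j) + y * (e j + x * shift e j)
    ≡⟨ cong (λ v → (e (suc j) + x * e j) + y * v) (sym (esym-∷ x xs j)) ⟩
  mulLinear y (esym (x ∷ xs)) (suc j)
    ∎
  where e = esym xs

sumℚ-recip-choose : ∀ j zs →
  sumℚ (map (recipℤ ∘ productℤ) (choose j zs)) ≡ esym (map recipℤ zs) j
sumℚ-recip-choose zero    zs       = ℚP.+-identityʳ 1ℚ
sumℚ-recip-choose (suc j) []       = refl
sumℚ-recip-choose (suc j) (z ∷ zs) = begin
  sumℚ (map ρ (map (z ∷_) (choose j zs) ++ choose (suc j) zs))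
    ≡⟨ cong sumℚ (LP.map-++ ρ (map (z ∷_) (choose j zs)) (choose (suc j) zs)) ⟩
  sumℚ (map ρ (map (z ∷_) (choose j zs)) ++ map ρ (choose (suc j) zs))
    ≡⟨ sumℚ-++ (map ρ (map (z ∷_) (choose j zs))) (map ρ (choose (suc j) zs)) ⟩
  sumℚ (map ρ (map (z ∷_) (choose j zs))) + sumℚ (map ρ (choose (suc j) zs))
    ≡⟨ cong₂ _+_ with-z (sumℚ-recip-choose (suc j) zs) ⟩
  recipℤ z * esym (map recipℤ zs) j + esym (map recipℤ zs) (suc j)
    ≡⟨ ℚP.+-comm (recipℤ z * esym (map recipℤ zs) j) (esym (map recipℤ zs) (suc j)) ⟩
  esym (map recipℤ (z ∷ zs)) (suc j)
    ∎
  where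
  ρ : List ℤ → ℚ
  ρ = recipℤ ∘ productℤ
  with-z : sumℚ (map ρ (map (z ∷_) (choose j zs))) ≡ recipℤ z * esym (map recipℤ zs) j
  with-z = begin
    sumℚ (map ρ (map (z ∷_) (choose j zs)))
      ≡⟨ cong sumℚ (sym (LP.map-∘ (choose j zs))) ⟩
    sumℚ (map (λ I → recipℤ (z ℤ.* productℤ I)) (choose j zs))
      ≡⟨ cong sumℚ (LP.map-cong (λ I → recipℤ-* z (productℤ I)) (choose j zs)) ⟩
    sumℚ (map (λ I → recipℤ z * ρ I) (choose j zs))
      ≡⟨ sumℚ-map-*ˡ (recipℤ z) ρ (choose j zs) ⟩
    recipℤ z * sumℚ (map ρ (choose j zs))
      ≡⟨ cong (recipℤ z *_) (sumℚ-recip-choose j zs) ⟩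
    recipℤ z * esym (map recipℤ zs) j
      ∎

infixl 7 _⊛_

_⊛_ : Series → Series → Series
(f ⊛ g) K = Σ< (suc K) (λ j → f j * g (K ∸ j))

⊛-congˡ : ∀ {f f′} g → (∀ j → f j ≡ f′ j) → ∀ K → (f ⊛ g) K ≡ (f′ ⊛ g) K
⊛-congˡ g f≡f′ K = Σ<-cong (suc K) (λ j _ → cong (_* g (K ∸ j)) (f≡f′ j))

⊛-congʳ : ∀ f {g g′} → (∀ j → g j ≡ g′ j) → ∀ K → (f ⊛ g) K ≡ (f ⊛ g′) K
⊛-congʳ f g≡g′ K = Σ<-cong (suc K) (λ j _ → cong (f j *_) (g≡g′ (K ∸ j)))

⊛-identityˡ : ∀ g K → (esym [] ⊛ g) K ≡ g K
⊛-identityˡ g K = begin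
  1ℚ * g K + Σ< K (λ j → 0ℚ * g (K ∸ suc j))
    ≡⟨ cong₂ _+_ (ℚP.*-identityˡ (g K)) (trans (Σ<-*ˡ K 0ℚ h) (ℚP.*-zeroˡ (Σ< K h))) ⟩
  g K + 0ℚ
    ≡⟨ ℚP.+-identityʳ (g K) ⟩
  g K
    ∎
  where
  h : ℕ → ℚ
  h j = g (K ∸ suc j)

⊛-shiftˡ : ∀ f g K → (shift f ⊛ g) K ≡ shift (f ⊛ g) K
⊛-shiftˡ f g zero    = trans (ℚP.+-identityʳ (0ℚ * g 0)) (ℚP.*-zeroˡ (g 0))
⊛-shiftˡ f g (suc K) =
  trans (cong (_+ (f ⊛ g) K) (ℚP.*-zeroˡ (g (suc K)))) (ℚP.+-identityˡ ((f ⊛ g) K))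

⊛-shiftʳ : ∀ f g K → (f ⊛ shift g) K ≡ shift (f ⊛ g) K
⊛-shiftʳ f g zero    = trans (ℚP.+-identityʳ (f 0 * 0ℚ)) (ℚP.*-zeroʳ (f 0))
⊛-shiftʳ f g (suc K) = begin
  Σ< (suc (suc K)) (λ j → f j * shift g (suc K ∸ j))
    ≡⟨ Σ<-suc (suc K) (λ j → f j * shift g (suc K ∸ j)) ⟩
  Σ< (suc K) (λ j → f j * shift g (suc K ∸ j)) + f (suc K) * shift g (K ∸ K)
    ≡⟨ cong₂ _+_ (Σ<-cong (suc K) (λ j j<1+K →
                    cong (λ i → f j * shift g i) (ℕP.+-∸-assoc 1 (ℕP.≤-pred j<1+K))))
                 (trans (cong (λ i → f (suc K) * shift g i) (ℕP.n∸n≡0 K)) (ℚP.*-zeroʳ (f (suc K)))) ⟩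
  (f ⊛ g) K + 0ℚ
    ≡⟨ ℚP.+-identityʳ ((f ⊛ g) K) ⟩
  (f ⊛ g) K
    ∎

⊛-linearˡ : ∀ x f h g K → ((λ j → f j + x * h j) ⊛ g) K ≡ (f ⊛ g) K + x * (h ⊛ g) K
⊛-linearˡ x f h g K = begin
  Σ< (suc K) (λ j → (f j + x * h j) * g (K ∸ j))
    ≡⟨ Σ<-cong (suc K) (λ j _ → solve 4 (λ x a b c → (a :+ x :* b) :* c := a :* c :+ x :* (b :* c))
                                        refl x (f j) (h j) (g (K ∸ j))) ⟩
  Σ< (suc K) (λ j → f j * g (K ∸ j) + x * (h j * g (K ∸ j)))
    ≡⟨ Σ<-+ (suc K) (λ j → f j * g (K ∸ j)) (λ j → x * (h j * g (K ∸ j))) ⟩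
  (f ⊛ g) K + Σ< (suc K) (λ j → x * (h j * g (K ∸ j)))
    ≡⟨ cong (_+_ ((f ⊛ g) K)) (Σ<-*ˡ (suc K) x (λ j → h j * g (K ∸ j))) ⟩
  (f ⊛ g) K + x * (h ⊛ g) K
    ∎

⊛-linearʳ : ∀ x f g h K → (f ⊛ (λ j → g j + x * h j)) K ≡ (f ⊛ g) K + x * (f ⊛ h) K
⊛-linearʳ x f g h K = begin
  Σ< (suc K) (λ j → f j * (g (K ∸ j) + x * h (K ∸ j)))
    ≡⟨ Σ<-cong (suc K) (λ j _ → solve 4 (λ x a b c → a :* (b :+ x :* c) := a :* b :+ x :* (a :* c))
                                        refl x (f j) (g (K ∸ j)) (h (K ∸ j))) ⟩
  Σ< (suc K) (λ j → f j * g (K ∸ j) + x * (f j * h (K ∸ j)))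
    ≡⟨ Σ<-+ (suc K) (λ j → f j * g (K ∸ j)) (λ j → x * (f j * h (K ∸ j))) ⟩
  (f ⊛ g) K + Σ< (suc K) (λ j → x * (f j * h (K ∸ j)))
    ≡⟨ cong (_+_ ((f ⊛ g) K)) (Σ<-*ˡ (suc K) x (λ j → f j * h (K ∸ j))) ⟩
  (f ⊛ g) K + x * (f ⊛ h) K
    ∎

⊛-mulLinearˡ : ∀ x f g K → (mulLinear x f ⊛ g) K ≡ mulLinear x (f ⊛ g) K
⊛-mulLinearˡ x f g K =
  trans (⊛-linearˡ x f (shift f) g K) (cong (λ s → (f ⊛ g) K + x * s) (⊛-shiftˡ f g K))

⊛-mulLinearʳ : ∀ x f g K → (f ⊛ mulLinear x g) K ≡ mulLinear x (f ⊛ g) K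
⊛-mulLinearʳ x f g K =
  trans (⊛-linearʳ x f g (shift g) K) (cong (λ s → (f ⊛ g) K + x * s) (⊛-shiftʳ f g K))

interval-suc : ∀ lo len → interval lo (suc len) ≡ lo ∷ interval (ℤ.suc lo) len
interval-suc lo len = cong₂ _∷_ (ℤP.+-identityʳ lo) (applyUpTo-cong len (λ t _ → begin
  lo ℤ.+ (+ 1 ℤ.+ + t)    ≡⟨ sym (ℤP.+-assoc lo (+ 1) (+ t)) ⟩
  (lo ℤ.+ + 1) ℤ.+ + t    ≡⟨ cong (ℤ._+ + t) (ℤP.+-comm lo (+ 1)) ⟩
  ℤ.suc lo ℤ.+ + t        ∎))

negRecips : ℕ → List ℚ
negRecips a = map recipℤ (interval (ℤ.- (+ a)) a)

posRecips : ℕ → List ℚ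
posRecips m = map recipℤ (interval (+ 1) m)

negRecips-suc : ∀ a → negRecips (suc a) ≡ recipℤ -[1+ a ] ∷ negRecips a
negRecips-suc a = cong (map recipℤ)
  (trans (interval-suc -[1+ a ] a) (cong (λ lo → -[1+ a ] ∷ interval lo a) (suc-[1+n]≡-n a)))
  where
  suc-[1+n]≡-n : ∀ n → ℤ.suc -[1+ n ] ≡ ℤ.- (+ n)
  suc-[1+n]≡-n zero    = refl
  suc-[1+n]≡-n (suc n) = refl

posRecips-suc : ∀ m → posRecips (suc m) ≡ posRecips m ∷ʳ recipℤ (+ suc m)
posRecips-suc m = trans (cong (map recipℤ) (sym (LP.applyUpTo-∷ʳ (λ t → + 1 ℤ.+ + t) m)))
                        (LP.map-++ recipℤ (interval (+ 1) m) (+ suc m ∷ []))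

F : ℕ → ℕ → Series
F a m = esym (negRecips a) ⊛ esym (posRecips m)

F-sucˡ : ∀ a m K → F (suc a) m K ≡ mulLinear (recipℤ -[1+ a ]) (F a m) K
F-sucˡ a m K = begin
  (esym (negRecips (suc a)) ⊛ q) K          ≡⟨ cong (λ xs → (esym xs ⊛ q) K) (negRecips-suc a) ⟩
  (esym (r ∷ negRecips a) ⊛ q) K            ≡⟨ ⊛-congˡ q (esym-∷ r (negRecips a)) K ⟩
  (mulLinear r (esym (negRecips a)) ⊛ q) K  ≡⟨ ⊛-mulLinearˡ r (esym (negRecips a)) q K ⟩
  mulLinear r (F a m) K                     ∎
  where
  r = recipℤ -[1+ a ]
  q = esym (posRecips m)

F-sucʳ : ∀ a m K → F a (suc m) K ≡ mulLinear (recipℤ (+ suc m)) (F a m) K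
F-sucʳ a m K = begin
  (p ⊛ esym (posRecips (suc m))) K          ≡⟨ cong (λ xs → (p ⊛ esym xs) K) (posRecips-suc m) ⟩
  (p ⊛ esym (posRecips m ∷ʳ r)) K           ≡⟨ ⊛-congʳ p (esym-∷ʳ (posRecips m) r) K ⟩
  (p ⊛ mulLinear r (esym (posRecips m))) K  ≡⟨ ⊛-mulLinearʳ r p (esym (posRecips m)) K ⟩
  mulLinear r (F a m) K                     ∎
  where
  r = recipℤ (+ suc m)
  p = esym (negRecips a)

F-recurrence : ∀ a m K →
  fromℕ (suc a) * F (suc a) m K + fromℕ (suc m) * F a (suc m) K ≡ fromℕ (suc a ℕ.+ suc m) * F a m K
F-recurrence a m K = begin
  c * F (suc a) m K + d * F a (suc m) K
    ≡⟨ cong₂ (λ u v → c * u + d * v) (F-sucˡ a m K) (F-sucʳ a m K) ⟩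
  c * mulLinear (recipℤ -[1+ a ]) (F a m) K + d * mulLinear (recipℤ (+ suc m)) (F a m) K
    ≡⟨ mulLinear-cancel c d (recipℤ -[1+ a ]) (recipℤ (+ suc m)) (F a m) K weights-cancel ⟩
  (c + d) * F a m K
    ≡⟨ cong (_* F a m K) (sym (fromℕ-+ (suc a) (suc m))) ⟩
  fromℕ (suc a ℕ.+ suc m) * F a m K
    ∎
  where
  c = fromℕ (suc a)
  d = fromℕ (suc m)
  weights-cancel : c * recipℤ -[1+ a ] + d * recipℤ (+ suc m) ≡ 0ℚ
  weights-cancel = begin
    c * recipℤ -[1+ a ] + d * recipℤ (+ suc m)
      ≡⟨ cong (λ r → c * r + d * recipℤ (+ suc m)) (recipℤ-neg a) ⟩
    c * - recipℤ (+ suc a) + d * recipℤ (+ suc m)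
      ≡⟨ cong (_+ d * recipℤ (+ suc m)) (sym (ℚP.neg-distribʳ-* c (recipℤ (+ suc a)))) ⟩
    - (c * recipℤ (+ suc a)) + d * recipℤ (+ suc m)
      ≡⟨ cong₂ (λ u v → - u + v) (fromℕ-*-recipℤ a) (fromℕ-*-recipℤ m) ⟩
    - 1ℚ + 1ℚ
      ≡⟨ ℚP.+-inverseˡ 1ℚ ⟩
    0ℚ
      ∎

antidiagonal : ℕ → Series
antidiagonal N K = Σ< (suc N) (λ a → F a (N ∸ a) K)

antidiagonal-step : ∀ N K →
  fromℕ (suc N) * antidiagonal (suc N) K ≡ fromℕ (suc (suc N)) * antidiagonal N K
antidiagonal-step N K = begin
  fromℕ (suc N) * antidiagonal (suc N) K
    ≡⟨ sym (Σ<-*ˡ (suc (suc N)) (fromℕ (suc N)) G) ⟩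
  Σ< (suc (suc N)) (λ a → fromℕ (suc N) * G a)
    ≡⟨ Σ<-cong (suc (suc N)) (λ a a<2+N → split-weight a (ℕP.≤-pred a<2+N)) ⟩
  Σ< (suc (suc N)) (λ a → fromℕ a * G a + fromℕ (suc N ∸ a) * G a)
    ≡⟨ Σ<-+-shiftˡ (suc N) (λ a → fromℕ a * G a) (λ a → fromℕ (suc N ∸ a) * G a)
                   (ℚP.*-zeroˡ (G 0))
                   (trans (cong (λ i → fromℕ i * G (suc N)) (ℕP.n∸n≡0 N)) (ℚP.*-zeroˡ (G (suc N)))) ⟩
  Σ< (suc N) (λ a → fromℕ (suc a) * G (suc a) + fromℕ (suc N ∸ a) * G a)
    ≡⟨ Σ<-cong (suc N) (λ a a<1+N → recurrence-at a (ℕP.≤-pred a<1+N)) ⟩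
  Σ< (suc N) (λ a → fromℕ (suc (suc N)) * F a (N ∸ a) K)
    ≡⟨ Σ<-*ˡ (suc N) (fromℕ (suc (suc N))) (λ a → F a (N ∸ a) K) ⟩
  fromℕ (suc (suc N)) * antidiagonal N K
    ∎
  where
  G : ℕ → ℚ
  G a = F a (suc N ∸ a) K

  split-weight : ∀ a → a ≤ suc N →
    fromℕ (suc N) * G a ≡ fromℕ a * G a + fromℕ (suc N ∸ a) * G a
  split-weight a a≤1+N = begin
    fromℕ (suc N) * G a                      ≡⟨ cong (λ i → fromℕ i * G a) (sym (ℕP.m+[n∸m]≡n a≤1+N)) ⟩
    fromℕ (a ℕ.+ (suc N ∸ a)) * G a          ≡⟨ cong (_* G a) (fromℕ-+ a (suc N ∸ a)) ⟩
    (fromℕ a + fromℕ (suc N ∸ a)) * G a      ≡⟨ ℚP.*-distribʳ-+ (G a) (fromℕ a) (fromℕ (suc N ∸ a)) ⟩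
    fromℕ a * G a + fromℕ (suc N ∸ a) * G a  ∎

  recurrence-at : ∀ a → a ≤ N →
    fromℕ (suc a) * G (suc a) + fromℕ (suc N ∸ a) * G a ≡ fromℕ (suc (suc N)) * F a (N ∸ a) K
  recurrence-at a a≤N = begin
    fromℕ (suc a) * F (suc a) m K + fromℕ (suc N ∸ a) * F a (suc N ∸ a) K
      ≡⟨ cong (λ i → fromℕ (suc a) * F (suc a) m K + fromℕ i * F a i K) (ℕP.+-∸-assoc 1 a≤N) ⟩
    fromℕ (suc a) * F (suc a) m K + fromℕ (suc m) * F a (suc m) K
      ≡⟨ F-recurrence a m K ⟩
    fromℕ (suc a ℕ.+ suc m) * F a m K
      ≡⟨ cong (λ i → fromℕ (suc i) * F a m K) (trans (ℕP.+-suc a m) (cong suc (ℕP.m+[n∸m]≡n a≤N))) ⟩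
    fromℕ (suc (suc N)) * F a m K
      ∎
    where m = N ∸ a

antidiagonal-vanishes : ∀ N K → antidiagonal N (suc K) ≡ 0ℚ
antidiagonal-vanishes zero    K =
  trans (ℚP.+-identityʳ (F 0 0 (suc K))) (⊛-identityˡ (esym []) (suc K))
antidiagonal-vanishes (suc N) K = fromℕ[1+n]*x≡0⇒x≡0 N (begin
  fromℕ (suc N) * antidiagonal (suc N) (suc K)  ≡⟨ antidiagonal-step N (suc K) ⟩
  fromℕ (suc (suc N)) * antidiagonal N (suc K)  ≡⟨ cong (fromℕ (suc (suc N)) *_) (antidiagonal-vanishes N K) ⟩
  fromℕ (suc (suc N)) * 0ℚ                      ≡⟨ ℚP.*-zeroʳ (fromℕ (suc (suc N))) ⟩
  0ℚ                                            ∎)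

innerSum-factorises : ∀ n k a j →
  innerSum n k a j ≡ esym (negRecips a) j * esym (posRecips (n ∸ 1 ∸ a)) (k ∸ 1 ∸ j)
innerSum-factorises n k a j = trans
  (sumℚ-concatMap-separable _ (recipℤ ∘ productℤ) (recipℤ ∘ productℤ)
     (λ I I′ → recipℤ-* (productℤ I) (productℤ I′))
     (negTuples a j) (posTuples (n ∸ 1 ∸ a) (k ∸ 1 ∸ j)))
  (cong₂ _*_ (sumℚ-recip-choose j _) (sumℚ-recip-choose (k ∸ 1 ∸ j) _))

lemma5p12 : (k : ℕ) → 1 < k → (n : ℕ) → 0 < n →
    Σ< n (λ a → Σ< k (λ j → innerSum n k a j)) ≡ 0ℚ
lemma5p12 (suc (suc K)) _ (suc N) _ = begin
  Σ< (suc N) (λ a → Σ< (suc (suc K)) (λ j → innerSum (suc N) (suc (suc K)) a j))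
    ≡⟨ Σ<-cong (suc N) (λ a _ → Σ<-cong (suc (suc K)) (λ j _ →
         innerSum-factorises (suc N) (suc (suc K)) a j)) ⟩
  antidiagonal N (suc K)
    ≡⟨ antidiagonal-vanishes N K ⟩
  0ℚ
    ∎
lemma5p12 (suc zero) (s≤s ())
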